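{- Let $G$ be any group with identity $e$. Then in $\Delta 334(G)$ the vertex $e$ is adjacent to itself and is adjacent to no other vertex. Moreover, $e$ is the only vertex of $\Delta 334(G)$ that is adjacent to itself.
   Context: For a group $G$ with identity $e$, the 334-triangle graph $\Delta 334(G)$ is the undirected graph (loops allowed) whose vertices are the elements $a\in G$ with $a^3=e$, with an edge between vertices $a$ and $b$ (possibly $a=b$) if and only if $(ab)^4=e$. -}

module Defs where

open import Level using (Level)
open import Algebra.Bundles using (Group)
open import Data.Product using (_×_)

module Δ334 {c ℓ : Level} (G : Group c ℓ) where
  open Group G

  _^3 : Carrier → Carrier
  a ^3 = a ∙ (a ∙ a)

  _^4 : Carrier → Carrier
  a ^4 = a ∙ (a ∙ (a ∙ a))

  IsVertex : Carrier → Set ℓ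
  IsVertex a = a ^3 ≈ ε

  Adjacent : Carrier → Carrier → Set ℓ
  Adjacent a b = IsVertex a × IsVertex b × (a ∙ b) ^4 ≈ ε

-- A vertex a satisfies a ^4 = a, so a vertex with a ^4 = e is e itself. A neighbour b of e is
-- such a vertex, since e b = b. For a loop at a, the element a a is again a vertex
-- ((a a) ^3 = a ^6 = e) whose fourth power is e, so a a = e and then a = a ^4 = a (a (a a)) = e.
module Submission where

open import Defs
open import Level using (Level)
open import Algebra.Bundles using (Group)
open import Data.Product using (_×_; _,_)
import Relation.Binary.Reasoning.Setoid as SetoidReasoning

module Δ334Properties {c ℓ : Level} (G : Group c ℓ) where
  open Group G
  open Δ334 G
  open SetoidReasoning setoid

  ^3≈ε⇒cancelˡ : ∀ {a} → a ^3 ≈ ε → ∀ x → a ∙ (a ∙ (a ∙ x)) ≈ x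
  ^3≈ε⇒cancelˡ {a} a³≈ε x = begin
    a ∙ (a ∙ (a ∙ x)) ≈⟨ ∙-congˡ (sym (assoc a a x)) ⟩
    a ∙ ((a ∙ a) ∙ x) ≈⟨ sym (assoc a (a ∙ a) x) ⟩
    a ^3 ∙ x          ≈⟨ ∙-congʳ a³≈ε ⟩
    ε ∙ x             ≈⟨ identityˡ x ⟩
    x                 ∎

  vertex-^4≈ε⇒≈ε : ∀ {a} → IsVertex a → a ^4 ≈ ε → a ≈ ε
  vertex-^4≈ε⇒≈ε {a} vertex a⁴≈ε = trans (sym (^3≈ε⇒cancelˡ vertex a)) a⁴≈ε

  ^4-cong : ∀ {a b} → a ≈ b → a ^4 ≈ b ^4
  ^4-cong a≈b = ∙-cong a≈b (∙-cong a≈b (∙-cong a≈b a≈b))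

  ε-isVertex : IsVertex ε
  ε-isVertex = trans (identityˡ (ε ∙ ε)) (identityˡ ε)

  ε-adjacent-ε : Adjacent ε ε
  ε-adjacent-ε = ε-isVertex , ε-isVertex , (begin
    (ε ∙ ε) ^4 ≈⟨ ^4-cong (identityˡ ε) ⟩
    ε ∙ ε ^3   ≈⟨ ∙-congˡ ε-isVertex ⟩
    ε ∙ ε      ≈⟨ identityˡ ε ⟩
    ε          ∎)

  adjacent-ε⇒≈ε : ∀ b → Adjacent ε b → b ≈ ε
  adjacent-ε⇒≈ε b (_ , b-vertex , [εb]⁴≈ε) =
    vertex-^4≈ε⇒≈ε b-vertex (trans (^4-cong (sym (identityˡ b))) [εb]⁴≈ε)

  square-isVertex : ∀ {a} → IsVertex a → IsVertex (a ∙ a)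
  square-isVertex {a} vertex = begin
    (a ∙ a) ∙ ((a ∙ a) ∙ (a ∙ a)) ≈⟨ assoc a a _ ⟩
    a ∙ (a ∙ ((a ∙ a) ∙ (a ∙ a))) ≈⟨ ∙-congˡ (∙-congˡ (assoc a a (a ∙ a))) ⟩
    a ∙ (a ∙ (a ∙ a ^3))          ≈⟨ ^3≈ε⇒cancelˡ vertex (a ^3) ⟩
    a ^3                          ≈⟨ vertex ⟩
    ε                             ∎

  adjacent-self⇒≈ε : ∀ a → Adjacent a a → a ≈ ε
  adjacent-self⇒≈ε a (vertex , _ , [aa]⁴≈ε) = begin
    a                 ≈⟨ sym (^3≈ε⇒cancelˡ vertex a) ⟩
    a ∙ (a ∙ (a ∙ a)) ≈⟨ ∙-congˡ (∙-congˡ aa≈ε) ⟩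
    a ∙ (a ∙ ε)       ≈⟨ ∙-congˡ (identityʳ a) ⟩
    a ∙ a             ≈⟨ aa≈ε ⟩
    ε                 ∎
    where
    aa≈ε : a ∙ a ≈ ε
    aa≈ε = vertex-^4≈ε⇒≈ε (square-isVertex vertex) [aa]⁴≈ε

lemma1 : {c ℓ : Level} (G : Group c ℓ) →
    Δ334.IsVertex G (Group.ε G) × Δ334.Adjacent G (Group.ε G) (Group.ε G)
      × (∀ b → Δ334.Adjacent G (Group.ε G) b → Group._≈_ G b (Group.ε G))
      × (∀ a → Δ334.Adjacent G a a → Group._≈_ G a (Group.ε G))
lemma1 G = ε-isVertex , ε-adjacent-ε , adjacent-ε⇒≈ε , adjacent-self⇒≈ε
  where open Δ334Properties G
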